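{- Let $m,n$ be nonnegative integers and $\Gamma={\rm SR}(m,n)$. (i) Any two adjacent vertices $u,v$ uniquely determine three cliques $C_1,C_2,C_3$ containing $u$ and $v$, where $C_i$ is the largest clique of type $i$ containing $u$ and $v$ ($i=1,2,3$), such that $C_i\cap C_j=\{u,v\}$ for distinct $i,j\in\{1,2,3\}$, and $C_1\cup C_2\cup C_3$ contains all common neighbors of $u$ and $v$. (ii) Fix a vertex $u$ and let $U$ be its set of neighbors. For each $i\in\{1,2,3\}$, the sets $C\setminus\{u\}$, where $C$ ranges over the maximal cliques of type $i$ containing $u$, form a partition of $U$. Moreover, each edge $vw$ with $v,w\in U$ is contained in a unique such clique (over all three types), and hence has a unique type. (iii) $\Gamma$ does not contain an induced subgraph isomorphic to the complete multipartite graph $K_{1,1,4}$.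
   Context: Let $\mathbb{N}$ denote the nonnegative integers. For $m,n\in\mathbb{N}$, the simplicial rook graph ${\rm SR}(m,n)$ has as vertices the vectors in $\mathbb{N}^m$ with coordinate sum $n$, two vertices being adjacent when they differ in precisely two coordinate positions. $e_i$ denotes the $i$-th standard unit vector. Clique types: a clique $C$ is of type 1 if there are fixed indices $j\ne k$ such that any two distinct vertices of $C$ differ exactly in coordinates $j,k$; of type 2 if $C=\{x+ae_i\mid i\in I\}$ with $1\le a\le n$, $x\in\mathbb{N}^m$ of coordinate sum $n-a$, $I\subseteq\{1,\ldots,m\}$; of type 3 if $C=\{x-ae_i\mid i\in I\}$ with $a\ge1$, $x\in\mathbb{N}^m$ of coordinate sum $n+a$, $I\subseteq\{1,\ldots,m\}$ and $x_i\ge a$ for $i\in I$. The type of an edge $vw$ in $U$ is the type of the clique $\{u,v,w\}$. -}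

module Defs where

open import Level using (0ℓ; Lift)
open import Data.Nat using (ℕ; _+_; _∸_; _≤_)
open import Data.Fin using (Fin; zero; suc)
open import Data.Vec using (Vec; lookup; updateAt; sum)
open import Data.Product using (Σ; ∃; ∃-syntax; _×_; _,_)
open import Data.Sum using (_⊎_)
open import Function using (_⇔_)
open import Relation.Binary.PropositionalEquality using (_≡_; _≢_)
open import Relation.Unary using (Pred; _∈_; _⊆_; _≐_; _∩_; _∪_)
open import Relation.Nullary using (¬_)

Pt : ℕ → Set
Pt m = Vec ℕ m

PtSet : ℕ → Set₁
PtSet m = Pred (Pt m) 0ℓ

IsVertex : {m : ℕ} → ℕ → Pt m → Set
IsVertex n x = sum x ≡ n

DiffPos : {m : ℕ} → Pt m → Pt m → Pred (Fin m) 0ℓ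
DiffPos x y i = lookup x i ≢ lookup y i

TwoIdx : {m : ℕ} → Fin m → Fin m → Pred (Fin m) 0ℓ
TwoIdx j k i = i ≡ j ⊎ i ≡ k

Adj : {m : ℕ} → Pt m → Pt m → Set
Adj x y = ∃[ j ] ∃[ k ] (j ≢ k × DiffPos x y ≐ TwoIdx j k)

Nbr : {m : ℕ} → ℕ → Pt m → Pt m → Set
Nbr n u w = IsVertex n w × Adj u w

IsClique : {m : ℕ} → ℕ → PtSet m → Set
IsClique n C = (C ⊆ IsVertex n) × (∀ {x y} → x ∈ C → y ∈ C → x ≢ y → Adj x y)

plusAt : {m : ℕ} → Pt m → ℕ → Fin m → Pt m
plusAt x a i = updateAt x i (_+ a)

minusAt : {m : ℕ} → Pt m → ℕ → Fin m → Pt m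
minusAt x a i = updateAt x i (_∸ a)

Type1 : {m : ℕ} → PtSet m → Set
Type1 {m} C = ∃[ j ] ∃[ k ] (j ≢ k ×
  (∀ {x y} → x ∈ C → y ∈ C → x ≢ y → DiffPos x y ≐ TwoIdx j k))

Type2 : {m : ℕ} → ℕ → PtSet m → Set₁
Type2 {m} n C = Σ ℕ λ a → Σ (Pt m) λ x → Σ (Pred (Fin m) 0ℓ) λ I →
  1 ≤ a × a ≤ n × sum x ≡ n ∸ a ×
  C ≐ (λ y → ∃[ i ] (i ∈ I × y ≡ plusAt x a i))

Type3 : {m : ℕ} → ℕ → PtSet m → Set₁
Type3 {m} n C = Σ ℕ λ a → Σ (Pt m) λ x → Σ (Pred (Fin m) 0ℓ) λ I →
  1 ≤ a × sum x ≡ n + a × (∀ i → i ∈ I → a ≤ lookup x i) ×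
  C ≐ (λ y → ∃[ i ] (i ∈ I × y ≡ minusAt x a i))

data CType : Set where
  type1 type2 type3 : CType

HasType : {m : ℕ} → CType → ℕ → PtSet m → Set₁
HasType type1 n C = Lift _ (Type1 C)
HasType type2 n C = Type2 n C
HasType type3 n C = Type3 n C

TypedClique : {m : ℕ} → ℕ → CType → PtSet m → Set₁
TypedClique n t C = IsClique n C × HasType t n C

LargestContaining : {m : ℕ} → ℕ → CType → Pt m → Pt m → PtSet m → Set₁
LargestContaining n t u v C = TypedClique n t C × u ∈ C × v ∈ C ×
  (∀ D → TypedClique n t D → u ∈ D → v ∈ D → D ⊆ C)

MaximalContaining : {m : ℕ} → ℕ → CType → Pt m → PtSet m → Set₁
MaximalContaining n t u C = TypedClique n t C × u ∈ C ×
  (∀ D → TypedClique n t D → C ⊆ D → D ⊆ C)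

Pair : {m : ℕ} → Pt m → Pt m → PtSet m
Pair u v y = y ≡ u ⊎ y ≡ v

Triple : {m : ℕ} → Pt m → Pt m → Pt m → PtSet m
Triple u v w y = y ≡ u ⊎ y ≡ v ⊎ y ≡ w

PartI : ℕ → ℕ → Set₁
PartI m n = (u v : Pt m) → IsVertex n u → IsVertex n v → Adj u v →
  Σ (PtSet m) λ C₁ → Σ (PtSet m) λ C₂ → Σ (PtSet m) λ C₃ →
    LargestContaining n type1 u v C₁ ×
    LargestContaining n type2 u v C₂ ×
    LargestContaining n type3 u v C₃ ×
    (C₁ ∩ C₂) ≐ Pair u v × (C₁ ∩ C₃) ≐ Pair u v × (C₂ ∩ C₃) ≐ Pair u v ×
    (∀ w → IsVertex n w → Adj u w → Adj v w → w ∈ (C₁ ∪ C₂ ∪ C₃))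

PartII : ℕ → ℕ → Set₁
PartII m n = (u : Pt m) → IsVertex n u →
  ((t : CType) →
     (∀ C → MaximalContaining n t u C → ∀ w → w ∈ C → w ≢ u → Nbr n u w) ×
     (∀ w → Nbr n u w → Σ (PtSet m) λ C → MaximalContaining n t u C × w ∈ C) ×
     (∀ C C' → MaximalContaining n t u C → MaximalContaining n t u C' →
        ∀ w → w ≢ u → w ∈ C → w ∈ C' → C ≐ C')) ×
  (∀ v w → Nbr n u v → Nbr n u w → Adj v w →
     (Σ CType λ t → Σ (PtSet m) λ C →
        MaximalContaining n t u C × v ∈ C × w ∈ C ×
        (∀ t' C' → MaximalContaining n t' u C' → v ∈ C' → w ∈ C' →
           t' ≡ t × C' ≐ C)) ×
     (Σ CType λ t → TypedClique n t (Triple u v w) ×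
        (∀ t' → TypedClique n t' (Triple u v w) → t' ≡ t)))

-- The complete multipartite graph K_{1,1,4} on Fin 6:
-- parts {0}, {1}, {2,3,4,5}; adjacent iff in different parts.
k114Part : Fin 6 → Fin 3
k114Part zero = zero
k114Part (suc zero) = suc zero
k114Part (suc (suc _)) = suc (suc zero)

K114Adj : Fin 6 → Fin 6 → Set
K114Adj i j = k114Part i ≢ k114Part j

PartIII : ℕ → ℕ → Set
PartIII m n = ¬ (Σ (Fin 6 → Pt m) λ f →
  (∀ i → IsVertex n (f i)) ×
  (∀ i j → f i ≡ f j → i ≡ j) ×
  (∀ i j → Adj (f i) (f j) ⇔ K114Adj i j))

module Submission where

-- Two adjacent vertices u, v differ in exactly two coordinates, so after
-- orienting the edge, v is obtained from u by a "move": b ≥ 1 units are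
-- transferred from a coordinate k to a coordinate j.  A move is determined by
-- its source together with (j, k, b), and conversely the source and target
-- determine (j, k, b).  These two uniqueness facts drive the whole proof.
--
-- Given the move u ⟶ v, the three largest cliques through the edge uv are
--   C₁ = vertices agreeing with u outside {j, k}                (type 1),
--   C₂ = { x₂ + b eᵢ }  with  x₂ = u − b e_k                    (type 2),
--   C₃ = { x₃ − b eᵢ | b ≤ (x₃)ᵢ }  with  x₃ = u + b e_j        (type 3).
-- Any type-2/3 clique through u and v is a family x ± a eᵢ whose members u, v
-- form a move; move uniqueness pins down its base point and step, giving
-- maximality.  A common neighbour w of u and v either agrees with u off {j,k}
-- (so w ∈ C₁) or is itself reached from u by a move whose shape forces
-- w ∈ C₂ or w ∈ C₃.  This is part (i), packaged as the record CliquesOnEdge;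
-- parts (ii) and (iii) are then purely set-theoretic consequences of it
-- (for (iii): four common neighbours of an edge fall into three cliques, so
-- two of them are adjacent by pigeonhole).

open import Level using (0ℓ; lift)
open import Data.Nat using (ℕ; _+_; _∸_; _≤_; z≤n; s≤s)
open import Data.Nat.Properties
open import Data.Nat.Tactic.RingSolver using (solve-∀)
open import Data.Fin using (Fin; zero; suc) renaming (_<_ to _<ᶠ_)
import Data.Fin.Properties as Fin
open import Data.Vec using (_∷_; lookup; updateAt; sum; tabulate)
open import Data.Vec.Properties
  using (lookup∘updateAt; lookup∘updateAt′; tabulate∘lookup; tabulate-cong;
         updateAt-updateAt-local; updateAt-id)
open import Data.Product using (Σ; ∃-syntax; _×_; _,_; proj₁; proj₂)
open import Data.Sum using (_⊎_; inj₁; inj₂; [_,_])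
open import Data.Unit using (⊤; tt)
open import Data.Empty using (⊥)
open import Function using (_∘_; id)
open import Function.Bundles using (Equivalence)
open import Relation.Binary using (tri<; tri≈; tri>)
open import Relation.Binary.PropositionalEquality hiding ([_])
open import Relation.Unary using (Pred; _∈_; _⊆_; _≐_; _∩_; _∪_)
open import Relation.Nullary using (Dec; yes; no; contradiction)
open import Relation.Nullary.Decidable using (_⊎-dec_; map′)
open import Defs

private variable
  m n : ℕ

-- Coordinate arithmetic for points of ℕ^m and the updates x ± a eᵢ.

coord : ∀ {x y : Pt m} i → x ≡ y → lookup x i ≡ lookup y i
coord i = cong (λ z → lookup z i)

pointwise⇒≡ : (x y : Pt m) → (∀ i → lookup x i ≡ lookup y i) → x ≡ y
pointwise⇒≡ x y h = begin
  x                  ≡⟨ tabulate∘lookup x ⟨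
  tabulate (lookup x) ≡⟨ tabulate-cong h ⟩
  tabulate (lookup y) ≡⟨ tabulate∘lookup y ⟩
  y                  ∎
  where open ≡-Reasoning

grow≢ : ∀ c {a} → 1 ≤ a → c + a ≢ c
grow≢ c (s≤s z≤n) = m+1+n≢m c

sum-updateAt : ∀ (x : Pt m) i (f : ℕ → ℕ) →
               sum (updateAt x i f) + lookup x i ≡ sum x + f (lookup x i)
sum-updateAt (c ∷ x) zero    f = swap-ends (f c) (sum x) c
  where swap-ends : ∀ d s c → d + s + c ≡ c + s + d
        swap-ends = solve-∀
sum-updateAt (c ∷ x) (suc i) f = begin
  c + sum (updateAt x i f) + lookup x i   ≡⟨ +-assoc c _ _ ⟩
  c + (sum (updateAt x i f) + lookup x i) ≡⟨ cong (c +_) (sum-updateAt x i f) ⟩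
  c + (sum x + f (lookup x i))            ≡⟨ +-assoc c _ _ ⟨
  c + sum x + f (lookup x i)              ∎
  where open ≡-Reasoning

lookup≤sum : ∀ (x : Pt m) i → lookup x i ≤ sum x
lookup≤sum (c ∷ x) zero    = m≤m+n c (sum x)
lookup≤sum (c ∷ x) (suc i) = ≤-trans (lookup≤sum x i) (m≤n+m (sum x) c)

lookup-plusAt : ∀ (x : Pt m) a i → lookup (plusAt x a i) i ≡ lookup x i + a
lookup-plusAt x a i = lookup∘updateAt i x

lookup-plusAt′ : ∀ (x : Pt m) a {i j} → j ≢ i → lookup (plusAt x a i) j ≡ lookup x j
lookup-plusAt′ x a {i} {j} j≢i = lookup∘updateAt′ j i j≢i x

lookup-minusAt : ∀ (x : Pt m) a i → lookup (minusAt x a i) i ≡ lookup x i ∸ a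
lookup-minusAt x a i = lookup∘updateAt i x

lookup-minusAt′ : ∀ (x : Pt m) a {i j} → j ≢ i → lookup (minusAt x a i) j ≡ lookup x j
lookup-minusAt′ x a {i} {j} j≢i = lookup∘updateAt′ j i j≢i x

lookup-minusAt-≤ : ∀ (x : Pt m) a i j → lookup (minusAt x a i) j ≤ lookup x j
lookup-minusAt-≤ x a i j with j Fin.≟ i
... | yes refl = ≤-trans (≤-reflexive (lookup-minusAt x a i)) (m∸n≤m _ a)
... | no j≢i   = ≤-reflexive (lookup-minusAt′ x a j≢i)

minusAt-plusAt : ∀ (x : Pt m) a i → minusAt (plusAt x a i) a i ≡ x
minusAt-plusAt x a i =
  trans (updateAt-updateAt-local i {h = id} x (m+n∸n≡m _ a)) (updateAt-id i x)

plusAt-minusAt : ∀ (x : Pt m) a i → a ≤ lookup x i → plusAt (minusAt x a i) a i ≡ x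
plusAt-minusAt x a i a≤xᵢ =
  trans (updateAt-updateAt-local i {h = id} x (m∸n+n≡m a≤xᵢ)) (updateAt-id i x)

sum-plusAt : ∀ (x : Pt m) a i → sum (plusAt x a i) ≡ sum x + a
sum-plusAt x a i = +-cancelʳ-≡ (lookup x i) _ _
  (trans (sum-updateAt x i (_+ a)) (regroup (sum x) (lookup x i) a))
  where regroup : ∀ s c a → s + (c + a) ≡ s + a + c
        regroup = solve-∀

sum-minusAt : ∀ (x : Pt m) a i → a ≤ lookup x i → sum (minusAt x a i) + a ≡ sum x
sum-minusAt x a i a≤xᵢ = begin
  sum (minusAt x a i) + a              ≡⟨ sum-plusAt (minusAt x a i) a i ⟨
  sum (plusAt (minusAt x a i) a i)     ≡⟨ cong sum (plusAt-minusAt x a i a≤xᵢ) ⟩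
  sum x                                ∎
  where open ≡-Reasoning

-- Adjacency in coordinates: the positions where two points differ.

AgreeOff : Pt m → Pt m → Fin m → Fin m → Set
AgreeOff x y j k = ∀ i → i ≢ j → i ≢ k → lookup x i ≡ lookup y i

∉-pair : ∀ {j k i x : Fin m} → x ≡ j ⊎ x ≡ k → i ≢ j → i ≢ k → i ≢ x
∉-pair (inj₁ refl) i≢j _   = i≢j
∉-pair (inj₂ refl) _   i≢k = i≢k

agreeOff-≡ : ∀ {x y : Pt m} {j k} → AgreeOff x y j k →
             lookup x j ≡ lookup y j → lookup x k ≡ lookup y k → x ≡ y
agreeOff-≡ {x = x} {y} {j} {k} agree eqⱼ eqₖ = pointwise⇒≡ x y at
  where
  at : ∀ i → lookup x i ≡ lookup y i
  at i with i Fin.≟ j | i Fin.≟ k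
  ... | yes refl | _        = eqⱼ
  ... | no _     | yes refl = eqₖ
  ... | no i≢j   | no i≢k   = agree i i≢j i≢k

erase₂ : Fin m → Fin m → Pt m → Pt m
erase₂ j k x = updateAt (updateAt x k (λ _ → 0)) j (λ _ → 0)

sum-erase₂ : ∀ (x : Pt m) {j k} → j ≢ k →
             sum x ≡ sum (erase₂ j k x) + (lookup x j + lookup x k)
sum-erase₂ x {j} {k} j≢k = begin
  sum x                                     ≡⟨ erase x k ⟩
  sum x₋ₖ + lookup x k                      ≡⟨ cong (_+ lookup x k) (erase x₋ₖ j) ⟩
  sum (erase₂ j k x) + lookup x₋ₖ j + lookup x k
    ≡⟨ cong (λ c → sum (erase₂ j k x) + c + lookup x k) (lookup∘updateAt′ j k j≢k x) ⟩
  sum (erase₂ j k x) + lookup x j + lookup x k ≡⟨ +-assoc (sum (erase₂ j k x)) _ _ ⟩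
  sum (erase₂ j k x) + (lookup x j + lookup x k) ∎
  where
  open ≡-Reasoning
  x₋ₖ = updateAt x k (λ _ → 0)
  erase : ∀ (z : Pt _) i → sum z ≡ sum (updateAt z i (λ _ → 0)) + lookup z i
  erase z i = trans (sym (+-identityʳ (sum z))) (sym (sum-updateAt z i (λ _ → 0)))

erase₂-agree : ∀ {x y : Pt m} {j k} → AgreeOff x y j k → erase₂ j k x ≡ erase₂ j k y
erase₂-agree {x = x} {y} {j} {k} agree = pointwise⇒≡ _ _ at
  where
  x₋ₖ y₋ₖ : Pt _
  x₋ₖ = updateAt x k (λ _ → 0)
  y₋ₖ = updateAt y k (λ _ → 0)
  at : ∀ i → lookup (erase₂ j k x) i ≡ lookup (erase₂ j k y) i
  at i with i Fin.≟ j | i Fin.≟ k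
  ... | yes refl | _        = trans (lookup∘updateAt i x₋ₖ) (sym (lookup∘updateAt i y₋ₖ))
  ... | no i≢j   | yes refl = begin
    lookup (erase₂ j i x) i ≡⟨ lookup∘updateAt′ i j i≢j x₋ₖ ⟩
    lookup x₋ₖ i            ≡⟨ lookup∘updateAt i x ⟩
    0                       ≡⟨ lookup∘updateAt i y ⟨
    lookup y₋ₖ i            ≡⟨ lookup∘updateAt′ i j i≢j y₋ₖ ⟨
    lookup (erase₂ j i y) i ∎
    where open ≡-Reasoning
  ... | no i≢j   | no i≢k   = begin
    lookup (erase₂ j k x) i
      ≡⟨ trans (lookup∘updateAt′ i j i≢j x₋ₖ) (lookup∘updateAt′ i k i≢k x) ⟩
    lookup x i              ≡⟨ agree i i≢j i≢k ⟩
    lookup y i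
      ≡⟨ trans (lookup∘updateAt′ i j i≢j y₋ₖ) (lookup∘updateAt′ i k i≢k y) ⟨
    lookup (erase₂ j k y) i ∎
    where open ≡-Reasoning

agreeOff-sum : ∀ {x y : Pt m} {j k} → j ≢ k → sum x ≡ sum y → AgreeOff x y j k →
               lookup x j + lookup x k ≡ lookup y j + lookup y k
agreeOff-sum {x = x} {y} {j} {k} j≢k sx≡sy agree = +-cancelˡ-≡ (sum (erase₂ j k y)) _ _ (begin
  sum (erase₂ j k y) + (lookup x j + lookup x k)
    ≡⟨ cong (λ z → sum z + (lookup x j + lookup x k)) (erase₂-agree {x = x} {y} agree) ⟨
  sum (erase₂ j k x) + (lookup x j + lookup x k) ≡⟨ sum-erase₂ x j≢k ⟨
  sum x                                          ≡⟨ sx≡sy ⟩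
  sum y                                          ≡⟨ sum-erase₂ y j≢k ⟩
  sum (erase₂ j k y) + (lookup y j + lookup y k) ∎)
  where open ≡-Reasoning

record DiffersAt (x y : Pt m) (j k : Fin m) : Set where
  field
    distinct : j ≢ k
    differ₁  : lookup x j ≢ lookup y j
    differ₂  : lookup x k ≢ lookup y k
    agree    : AgreeOff x y j k

differsAt-swap : ∀ {x y : Pt m} {j k} → DiffersAt x y j k → DiffersAt x y k j
differsAt-swap d = record
  { distinct = distinct ∘ sym ; differ₁ = differ₂ ; differ₂ = differ₁
  ; agree = λ i i≢k i≢j → agree i i≢j i≢k }
  where open DiffersAt d

differsAt-sym : ∀ {x y : Pt m} {j k} → DiffersAt x y j k → DiffersAt y x j k
differsAt-sym d = record
  { distinct = distinct ; differ₁ = differ₁ ∘ sym ; differ₂ = differ₂ ∘ sym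
  ; agree = λ i i≢j i≢k → sym (agree i i≢j i≢k) }
  where open DiffersAt d

differsAt-pos : ∀ {x y : Pt m} {j k} → DiffersAt x y j k →
                ∀ i → lookup x i ≢ lookup y i → i ≡ j ⊎ i ≡ k
differsAt-pos {j = j} {k} d i xᵢ≢yᵢ with i Fin.≟ j | i Fin.≟ k
... | yes i≡j | _       = inj₁ i≡j
... | no _    | yes i≡k = inj₂ i≡k
... | no i≢j  | no i≢k  = contradiction (DiffersAt.agree d i i≢j i≢k) xᵢ≢yᵢ

differsAt-align : ∀ {x y : Pt m} {r s q} → DiffersAt x y r s →
                  lookup x q ≢ lookup y q → ∃[ r′ ] DiffersAt x y r′ q
differsAt-align {r = r} {s} d differ-at-q with differsAt-pos d _ differ-at-q
... | inj₁ refl = s , differsAt-swap d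
... | inj₂ refl = r , d

adj⇒differsAt : ∀ {x y : Pt m} → Adj x y → ∃[ j ] ∃[ k ] DiffersAt x y j k
adj⇒differsAt {x = x} {y} (j , k , j≢k , diff⊆ , ⊆diff) =
  j , k , record { distinct = j≢k ; differ₁ = ⊆diff (inj₁ refl)
                 ; differ₂ = ⊆diff (inj₂ refl) ; agree = agree }
  where
  agree : AgreeOff x y j k
  agree i i≢j i≢k with lookup x i ≟ lookup y i
  ... | yes xᵢ≡yᵢ = xᵢ≡yᵢ
  ... | no xᵢ≢yᵢ  = contradiction (diff⊆ xᵢ≢yᵢ) [ i≢j , i≢k ]

differsAt-diffPos : ∀ {x y : Pt m} {j k} → DiffersAt x y j k → DiffPos x y ≐ TwoIdx j k
differsAt-diffPos {x = x} {y} {j} {k} d = (λ {i} → differsAt-pos d i) , back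
  where
  open DiffersAt d
  back : TwoIdx j k ⊆ DiffPos x y
  back (inj₁ refl) = differ₁
  back (inj₂ refl) = differ₂

differsAt⇒adj : ∀ {x y : Pt m} {j k} → DiffersAt x y j k → Adj x y
differsAt⇒adj {j = j} {k} d = j , k , DiffersAt.distinct d , differsAt-diffPos d

adj⇒≢ : ∀ {x y : Pt m} → Adj x y → x ≢ y
adj⇒≢ {x = x} {y} adj x≡y with adj⇒differsAt {x = x} {y} adj
... | j , _ , d = DiffersAt.differ₁ d (coord j x≡y)

agreeOff⇒differsAt : ∀ {x y : Pt m} {j k} → j ≢ k → sum x ≡ sum y → AgreeOff x y j k →
                     x ≢ y → DiffersAt x y j k
agreeOff⇒differsAt {x = x} {y} {j} {k} j≢k sx≡sy agree x≢y = record
  { distinct = j≢k ; agree = agree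
  ; differ₁ = λ eqⱼ → x≢y (agreeOff-≡ {x = x} {y} agree eqⱼ
                (+-cancelˡ-≡ (lookup x j) _ _ (trans sums (cong (_+ lookup y k) (sym eqⱼ)))))
  ; differ₂ = λ eqₖ → x≢y (agreeOff-≡ {x = x} {y} agree
                (+-cancelʳ-≡ (lookup x k) _ _ (trans sums (cong (lookup y j +_) (sym eqₖ)))) eqₖ) }
  where sums = agreeOff-sum {x = x} {y} j≢k sx≡sy agree

-- Moves: the oriented form of an edge between points of equal sum.

record Move (u v : Pt m) (j k : Fin m) (b : ℕ) : Set where
  field
    separate : j ≢ k
    positive : 1 ≤ b
    gain     : lookup v j ≡ lookup u j + b
    loss     : lookup u k ≡ lookup v k + b
    steady   : AgreeOff u v j k

move-sym : ∀ {u v : Pt m} {j k b} → Move u v j k b → Move v u k j b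
move-sym mv = record
  { separate = separate ∘ sym ; positive = positive ; gain = loss ; loss = gain
  ; steady = λ i i≢k i≢j → sym (steady i i≢j i≢k) }
  where open Move mv

move⇒differsAt : ∀ {u v : Pt m} {j k b} → Move u v j k b → DiffersAt u v j k
move⇒differsAt {u = u} {v} {j} {k} mv = record
  { distinct = separate ; agree = steady
  ; differ₁ = λ eqⱼ → grow≢ (lookup u j) positive (trans (sym gain) (sym eqⱼ))
  ; differ₂ = λ eqₖ → grow≢ (lookup v k) positive (trans (sym loss) eqₖ) }
  where open Move mv

move⇒adj : ∀ {u v : Pt m} {j k b} → Move u v j k b → Adj u v
move⇒adj = differsAt⇒adj ∘ move⇒differsAt

move-gain-at : ∀ {u v : Pt m} {j k b p a} → Move u v j k b → 1 ≤ a →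
               lookup v p ≡ lookup u p + a → p ≡ j
move-gain-at {u = u} {v} {j} {k} {b} {p} {a} mv a≥1 vₚ≡uₚ+a with p Fin.≟ j | p Fin.≟ k
... | yes p≡j | _        = p≡j
... | no _    | yes refl = contradiction (trans loss (trans (cong (_+ b) vₚ≡uₚ+a) (+-assoc _ a b)))
                             (grow≢ (lookup u p) (≤-trans a≥1 (m≤m+n a b)) ∘ sym)
  where open Move mv
... | no p≢j  | no p≢k   = contradiction (trans (sym vₚ≡uₚ+a) (sym (Move.steady mv p p≢j p≢k)))
                             (grow≢ (lookup u p) a≥1)

move-unique : ∀ {u v : Pt m} {j k b j′ k′ b′} → Move u v j k b → Move u v j′ k′ b′ →
              j′ ≡ j × k′ ≡ k × b′ ≡ b
move-unique {u = u} mv mv′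
  with move-gain-at mv (Move.positive mv′) (Move.gain mv′)
     | move-gain-at (move-sym mv) (Move.positive mv′) (Move.loss mv′)
... | refl | refl =
  refl , refl , +-cancelˡ-≡ (lookup u _) _ _ (trans (sym (Move.gain mv′)) (Move.gain mv))

move-target-unique : ∀ {u v w : Pt m} {j k b} → Move u v j k b → Move u w j k b → v ≡ w
move-target-unique {u = u} {v} {w} {b = b} mv mw =
  agreeOff-≡ {x = v} {w}
    (λ i i≢j i≢k → trans (sym (Move.steady mv i i≢j i≢k)) (Move.steady mw i i≢j i≢k))
    (trans (Move.gain mv) (sym (Move.gain mw)))
    (+-cancelʳ-≡ b _ _ (trans (sym (Move.loss mv)) (Move.loss mw)))

-- an edge with a known gain at j is a move; the loss is forced by the sums
move-from-gain : ∀ {u w : Pt m} {j q b} → DiffersAt u w j q → sum u ≡ sum w → 1 ≤ b →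
                 lookup w j ≡ lookup u j + b → Move u w j q b
move-from-gain {u = u} {w} {j} {q} {b} d su≡sw b≥1 gain = record
  { separate = distinct ; positive = b≥1 ; gain = gain ; steady = agree
  ; loss = +-cancelˡ-≡ (lookup u j) _ _ (begin
      lookup u j + lookup u q       ≡⟨ agreeOff-sum {x = u} {w} distinct su≡sw agree ⟩
      lookup w j + lookup w q       ≡⟨ cong (_+ lookup w q) gain ⟩
      lookup u j + b + lookup w q   ≡⟨ regroup (lookup u j) b (lookup w q) ⟩
      lookup u j + (lookup w q + b) ∎) }
  where
  open DiffersAt d
  open ≡-Reasoning
  regroup : ∀ c b d → c + b + d ≡ c + (d + b)
  regroup = solve-∀

adj⇒move : ∀ {u v : Pt m} → sum u ≡ sum v → Adj u v → ∃[ j ] ∃[ k ] ∃[ b ] Move u v j k b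
adj⇒move {u = u} {v} su≡sv adj with adj⇒differsAt {x = u} {v} adj
... | j , k , d with <-cmp (lookup u j) (lookup v j)
...   | tri< lt _ _ = j , k , _ ,
          move-from-gain d su≡sv (m<n⇒0<n∸m lt) (sym (m+[n∸m]≡n (<⇒≤ lt)))
...   | tri≈ _ eq _ = contradiction eq (DiffersAt.differ₁ d)
...   | tri> _ _ gt = k , j , _ ,
          move-sym (move-from-gain (differsAt-sym d) (sym su≡sv)
                                   (m<n⇒0<n∸m gt) (sym (m+[n∸m]≡n (<⇒≤ gt))))

plusAt-move : ∀ (x : Pt m) {a p q} → p ≢ q → 1 ≤ a → Move (plusAt x a p) (plusAt x a q) q p a
plusAt-move x {a} {p} {q} p≢q a≥1 = record
  { separate = p≢q ∘ sym ; positive = a≥1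
  ; gain   = trans (lookup-plusAt x a q) (cong (_+ a) (sym (lookup-plusAt′ x a (p≢q ∘ sym))))
  ; loss   = trans (lookup-plusAt x a p) (cong (_+ a) (sym (lookup-plusAt′ x a p≢q)))
  ; steady = λ i i≢q i≢p → trans (lookup-plusAt′ x a i≢p) (sym (lookup-plusAt′ x a i≢q)) }

minusAt-move : ∀ (x : Pt m) {a p q} → p ≢ q → 1 ≤ a → a ≤ lookup x p → a ≤ lookup x q →
               Move (minusAt x a p) (minusAt x a q) p q a
minusAt-move x {a} {p} {q} p≢q a≥1 a≤xₚ a≤x_q = record
  { separate = p≢q ; positive = a≥1
  ; gain   = trans (lookup-minusAt′ x a p≢q)
               (trans (sym (m∸n+n≡m a≤xₚ)) (cong (_+ a) (sym (lookup-minusAt x a p))))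
  ; loss   = trans (lookup-minusAt′ x a (p≢q ∘ sym))
               (trans (sym (m∸n+n≡m a≤x_q)) (cong (_+ a) (sym (lookup-minusAt x a q))))
  ; steady = λ i i≢p i≢q → trans (lookup-minusAt′ x a i≢p) (sym (lookup-minusAt′ x a i≢q)) }

record CliquesOnEdge (n : ℕ) (u v : Pt m) : Set₁ where
  field
    clique  : CType → PtSet m
    largest : ∀ t → LargestContaining n t u v (clique t)
    meet    : ∀ {t t′} → t ≢ t′ → ∀ {y} → y ∈ clique t → y ∈ clique t′ → Pair u v y
    cover   : ∀ {w} → IsVertex n w → Adj u w → Adj v w →
              w ∈ clique type1 ∪ clique type2 ∪ clique type3

module ThroughEdge {m : ℕ} (n : ℕ) (u v : Pt m) (hu : IsVertex n u) (hv : IsVertex n v)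
                   {j k : Fin m} {b : ℕ} (mv : Move u v j k b) where
  open Move mv

  u≢v : u ≢ v
  u≢v = adj⇒≢ {x = u} {v} (move⇒adj mv)

  b≤uₖ : b ≤ lookup u k
  b≤uₖ = subst (b ≤_) (sym loss) (m≤n+m b _)

  C₁ : PtSet m
  C₁ y = IsVertex n y × AgreeOff y u j k

  u∈C₁ : u ∈ C₁
  u∈C₁ = hu , λ _ _ _ → refl

  v∈C₁ : v ∈ C₁
  v∈C₁ = hv , λ i i≢j i≢k → sym (steady i i≢j i≢k)

  C₁-differsAt : ∀ {x y} → x ∈ C₁ → y ∈ C₁ → x ≢ y → DiffersAt x y j k
  C₁-differsAt {x} {y} (hx , x~u) (hy , y~u) =
    agreeOff⇒differsAt {x = x} {y} separate (trans hx (sym hy))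
      (λ i i≢j i≢k → trans (x~u i i≢j i≢k) (sym (y~u i i≢j i≢k)))

  clique₁ : TypedClique n type1 C₁
  clique₁ = (proj₁ , λ {x} {y} x∈ y∈ x≢y → differsAt⇒adj {x = x} {y} (C₁-differsAt x∈ y∈ x≢y))
          , lift (j , k , separate , λ x∈ y∈ x≢y → differsAt-diffPos (C₁-differsAt x∈ y∈ x≢y))

  -- in a type-1 clique through u and v every pair differs where u and v do
  largest₁ : ∀ D → TypedClique n type1 D → u ∈ D → v ∈ D → D ⊆ C₁
  largest₁ D ((D⊆V , _) , lift (_ , _ , _ , diff)) u∈D v∈D {y} y∈D = D⊆V y∈D , y~u
    where
    y~u : AgreeOff y u j k
    y~u i i≢j i≢k with lookup y i ≟ lookup u i
    ... | yes yᵢ≡uᵢ = yᵢ≡uᵢ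
    ... | no yᵢ≢uᵢ  = contradiction (steady i i≢j i≢k)
                        (proj₂ (diff u∈D v∈D u≢v) (proj₁ (diff u∈D y∈D u≢y) (yᵢ≢uᵢ ∘ sym)))
      where u≢y : u ≢ y
            u≢y u≡y = yᵢ≢uᵢ (coord i (sym u≡y))

  x₂ : Pt m
  x₂ = minusAt u b k

  I₂ : Pred (Fin m) 0ℓ
  I₂ _ = ⊤

  C₂ : PtSet m
  C₂ y = ∃[ i ] (i ∈ I₂ × y ≡ plusAt x₂ b i)

  u≡₂ : plusAt x₂ b k ≡ u
  u≡₂ = plusAt-minusAt u b k b≤uₖ

  member₂-move : ∀ {i} → i ≢ k → Move u (plusAt x₂ b i) i k b
  member₂-move {i} i≢k =
    subst (λ z → Move z (plusAt x₂ b i) i k b) u≡₂ (plusAt-move x₂ (i≢k ∘ sym) positive)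

  v≡₂ : plusAt x₂ b j ≡ v
  v≡₂ = move-target-unique (member₂-move separate) mv

  sum-x₂ : sum x₂ + b ≡ n
  sum-x₂ = trans (sum-minusAt u b k b≤uₖ) hu

  clique₂ : TypedClique n type2 C₂
  clique₂ = (vertex , adjacent)
          , b , x₂ , I₂ , positive , b≤n
          , trans (sym (m+n∸n≡m (sum x₂) b)) (cong (_∸ b) sum-x₂) , id , id
    where
    vertex : C₂ ⊆ IsVertex n
    vertex (i , _ , refl) = trans (sum-plusAt x₂ b i) sum-x₂
    adjacent : ∀ {x y} → x ∈ C₂ → y ∈ C₂ → x ≢ y → Adj x y
    adjacent (i , _ , refl) (i′ , _ , refl) x≢y =
      move⇒adj (plusAt-move x₂ (x≢y ∘ cong (plusAt x₂ b)) positive)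
    b≤n : b ≤ n
    b≤n = ≤-trans b≤uₖ (subst (lookup u k ≤_) hu (lookup≤sum u k))

  -- u, v ∈ D = {x + a eᵢ} form a move, which forces a = b and x = x₂
  largest₂ : ∀ D → TypedClique n type2 D → u ∈ D → v ∈ D → D ⊆ C₂
  largest₂ D (_ , (a , x , _ , a≥1 , _ , _ , D⊆ , _)) u∈D v∈D y∈D
    with D⊆ u∈D | D⊆ v∈D | D⊆ y∈D
  ... | p , _ , u≡ | q , _ , v≡ | r , _ , y≡
    with move-unique mv (subst₂ (λ s t → Move s t q p a) (sym u≡) (sym v≡) (plusAt-move x p≢q a≥1))
    where p≢q : p ≢ q
          p≢q p≡q = u≢v (trans u≡ (trans (cong (plusAt x a) p≡q) (sym v≡)))
  ... | refl , refl , refl = r , tt , trans y≡ (cong (λ z → plusAt z b r) x≡x₂)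
    where x≡x₂ : x ≡ x₂
          x≡x₂ = trans (sym (minusAt-plusAt x b k)) (cong (λ z → minusAt z b k) (sym u≡))

  x₃ : Pt m
  x₃ = plusAt u b j

  I₃ : Pred (Fin m) 0ℓ
  I₃ i = b ≤ lookup x₃ i

  C₃ : PtSet m
  C₃ y = ∃[ i ] (i ∈ I₃ × y ≡ minusAt x₃ b i)

  u≡₃ : minusAt x₃ b j ≡ u
  u≡₃ = minusAt-plusAt u b j

  x₃-off-j : ∀ {i} → i ≢ j → lookup x₃ i ≡ lookup u i
  x₃-off-j = lookup-plusAt′ u b

  j∈I₃ : j ∈ I₃
  j∈I₃ = subst (b ≤_) (sym (lookup-plusAt u b j)) (m≤n+m b _)

  k∈I₃ : k ∈ I₃
  k∈I₃ = subst (b ≤_) (sym (x₃-off-j (separate ∘ sym))) b≤uₖ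

  member₃-move : ∀ {i} → i ≢ j → i ∈ I₃ → Move u (minusAt x₃ b i) j i b
  member₃-move {i} i≢j i∈I₃ =
    subst (λ z → Move z (minusAt x₃ b i) j i b) u≡₃ (minusAt-move x₃ (i≢j ∘ sym) positive j∈I₃ i∈I₃)

  v≡₃ : minusAt x₃ b k ≡ v
  v≡₃ = move-target-unique (member₃-move (separate ∘ sym) k∈I₃) mv

  clique₃ : TypedClique n type3 C₃
  clique₃ = (vertex , adjacent) , b , x₃ , I₃ , positive , sum-x₃ , (λ _ → id) , id , id
    where
    sum-x₃ : sum x₃ ≡ n + b
    sum-x₃ = trans (sum-plusAt u b j) (cong (_+ b) hu)
    vertex : C₃ ⊆ IsVertex n
    vertex (i , i∈I₃ , refl) = +-cancelʳ-≡ b _ _ (trans (sum-minusAt x₃ b i i∈I₃) sum-x₃)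
    adjacent : ∀ {x y} → x ∈ C₃ → y ∈ C₃ → x ≢ y → Adj x y
    adjacent (i , i∈I₃ , refl) (i′ , i′∈I₃ , refl) x≢y =
      move⇒adj (minusAt-move x₃ (x≢y ∘ cong (minusAt x₃ b)) positive i∈I₃ i′∈I₃)

  -- u, v ∈ D = {x − a eᵢ} form a move, which forces a = b and x = x₃
  largest₃ : ∀ D → TypedClique n type3 D → u ∈ D → v ∈ D → D ⊆ C₃
  largest₃ D (_ , (a , x , I , a≥1 , _ , a≤x , D⊆ , _)) u∈D v∈D y∈D
    with D⊆ u∈D | D⊆ v∈D | D⊆ y∈D
  ... | p , p∈I , u≡ | q , q∈I , v≡ | r , r∈I , y≡
    with move-unique mv (subst₂ (λ s t → Move s t p q a) (sym u≡) (sym v≡)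
                           (minusAt-move x p≢q a≥1 (a≤x p p∈I) (a≤x q q∈I)))
    where p≢q : p ≢ q
          p≢q p≡q = u≢v (trans u≡ (trans (cong (minusAt x a) p≡q) (sym v≡)))
  ... | refl , refl , refl =
    r , subst (λ z → b ≤ lookup z r) x≡x₃ (a≤x r r∈I) , trans y≡ (cong (λ z → minusAt z b r) x≡x₃)
    where x≡x₃ : x ≡ x₃
          x≡x₃ = trans (sym (plusAt-minusAt x b j (a≤x j p∈I))) (cong (λ z → plusAt z b j) (sym u≡))

  -- Pairwise intersections: a member x₂ + b eᵢ (resp. x₃ − b eᵢ) with i ∉ {j, k}
  -- changes coordinate i of u, so it lies in no other of the three cliques

  C₁∩C₂ : ∀ {y} → y ∈ C₁ → y ∈ C₂ → Pair u v y
  C₁∩C₂ (_ , y~u) (i , _ , refl) with i Fin.≟ k | i Fin.≟ j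
  ... | yes refl | _        = inj₁ u≡₂
  ... | no _     | yes refl = inj₂ v≡₂
  ... | no i≢k   | no i≢j   =
    contradiction (trans (sym (Move.gain (member₂-move i≢k))) (y~u i i≢j i≢k))
      (grow≢ (lookup u i) positive)

  C₁∩C₃ : ∀ {y} → y ∈ C₁ → y ∈ C₃ → Pair u v y
  C₁∩C₃ (_ , y~u) (i , i∈I₃ , refl) with i Fin.≟ j | i Fin.≟ k
  ... | yes refl | _        = inj₁ u≡₃
  ... | no _     | yes refl = inj₂ v≡₃
  ... | no i≢j   | no i≢k   =
    contradiction (trans (cong (_+ b) (sym (y~u i i≢j i≢k))) (sym (Move.loss (member₃-move i≢j i∈I₃))))
      (grow≢ (lookup u i) positive)

  C₂∩C₃ : ∀ {y} → y ∈ C₂ → y ∈ C₃ → Pair u v y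
  C₂∩C₃ (i , _ , refl) (i′ , _ , y≡) with i Fin.≟ k | i Fin.≟ j
  ... | yes refl | _        = inj₁ u≡₂
  ... | no _     | yes refl = inj₂ v≡₂
  ... | no i≢k   | no i≢j   = contradiction uᵢ+b≤uᵢ (<⇒≱ (m<m+n (lookup u i) positive))
    where
    open ≤-Reasoning
    uᵢ+b≤uᵢ : lookup u i + b ≤ lookup u i
    uᵢ+b≤uᵢ = begin
      lookup u i + b                 ≡⟨ Move.gain (member₂-move i≢k) ⟨
      lookup (plusAt x₂ b i) i       ≡⟨ coord i y≡ ⟩
      lookup (minusAt x₃ b i′) i     ≤⟨ lookup-minusAt-≤ x₃ b i′ i ⟩
      lookup x₃ i                    ≡⟨ x₃-off-j i≢j ⟩
      lookup u i                     ∎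

  -- Let w differ from u at {p, q} and from v at {r, q},
  -- where q ∉ {j, k}.  Each of j, k is a coordinate where u and v differ, hence
  -- where w differs from u or from v; so {j, k} = {p, r}.  If p = j then the
  -- edge u ⟶ w gains b at j (w agrees with v there) and w ∈ C₃; if p = k then
  -- w ⟶ u gains b at k and w ∈ C₂.

  module _ {w : Pt m} (hw : IsVertex n w) where

    splits : ∀ {p r q} → DiffersAt u w p q → DiffersAt v w r q →
             ∀ i → lookup u i ≢ lookup v i → i ≢ q → i ≡ p ⊎ i ≡ r
    splits du dv i uᵢ≢vᵢ i≢q with lookup u i ≟ lookup w i
    ... | yes uᵢ≡wᵢ = [ inj₂ , (λ i≡q → contradiction i≡q i≢q) ]
                        (differsAt-pos dv i (λ vᵢ≡wᵢ → uᵢ≢vᵢ (trans uᵢ≡wᵢ (sym vᵢ≡wᵢ))))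
    ... | no uᵢ≢wᵢ  = [ inj₁ , (λ i≡q → contradiction i≡q i≢q) ] (differsAt-pos du i uᵢ≢wᵢ)

    -- w agrees with v at j, so u ⟶ w moves b units into j; hence w ∈ C₃
    via-j : ∀ {q} → DiffersAt u w j q → DiffersAt v w k q → q ≢ j → w ∈ C₃
    via-j {q} du dv q≢j = q , q∈I₃ , sym (move-target-unique (member₃-move q≢j q∈I₃) mw)
      where
      wⱼ≡vⱼ : lookup w j ≡ lookup v j
      wⱼ≡vⱼ = sym (DiffersAt.agree dv j separate (q≢j ∘ sym))
      mw : Move u w j q b
      mw = move-from-gain du (trans hu (sym hw)) positive (trans wⱼ≡vⱼ gain)
      q∈I₃ : q ∈ I₃
      q∈I₃ = subst (b ≤_) (sym (trans (x₃-off-j q≢j) (Move.loss mw))) (m≤n+m b _)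

    -- w agrees with v at k, so w ⟶ u moves b units into k; hence w ∈ C₂
    via-k : ∀ {q} → DiffersAt u w k q → DiffersAt v w j q → q ≢ k → w ∈ C₂
    via-k {q} du dv q≢k = q , tt , sym (move-target-unique (member₂-move q≢k) mw)
      where
      wₖ≡vₖ : lookup w k ≡ lookup v k
      wₖ≡vₖ = sym (DiffersAt.agree dv k (separate ∘ sym) (q≢k ∘ sym))
      mw : Move u w q k b
      mw = move-sym (move-from-gain (differsAt-sym du) (trans hw (sym hu)) positive
                       (trans loss (cong (_+ b) (sym wₖ≡vₖ))))

    off-edge : ∀ {p q} → DiffersAt u w p q → Adj v w → q ≢ j → q ≢ k → w ∈ C₂ ∪ C₃
    off-edge {q = q} du v~w q≢j q≢k with adj⇒differsAt {x = v} {w} v~w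
    ... | _ , _ , dv₀ with differsAt-align dv₀ (DiffersAt.differ₂ du ∘ trans (steady q q≢j q≢k))
    ...   | _ , dv with splits du dv j uⱼ≢vⱼ (q≢j ∘ sym) | splits du dv k uₖ≢vₖ (q≢k ∘ sym)
      where open DiffersAt (move⇒differsAt mv) renaming (differ₁ to uⱼ≢vⱼ; differ₂ to uₖ≢vₖ)
    ...     | inj₁ refl | inj₂ refl = inj₂ (via-j du dv q≢j)
    ...     | inj₂ refl | inj₁ refl = inj₁ (via-k du dv q≢k)
    ...     | inj₁ refl | inj₁ k≡j  = contradiction (sym k≡j) separate
    ...     | inj₂ refl | inj₂ k≡j  = contradiction (sym k≡j) separate

    common-neighbour : Adj u w → Adj v w → w ∈ C₁ ∪ C₂ ∪ C₃
    common-neighbour u~w v~w with adj⇒differsAt {x = u} {w} u~w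
    ... | p , q , du with q Fin.≟ j ⊎-dec q Fin.≟ k | p Fin.≟ j ⊎-dec p Fin.≟ k
    ...   | no q∉  | _      = inj₂ (off-edge du v~w (q∉ ∘ inj₁) (q∉ ∘ inj₂))
    ...   | yes _  | no p∉  = inj₂ (off-edge (differsAt-swap du) v~w (p∉ ∘ inj₁) (p∉ ∘ inj₂))
    ...   | yes q∈ | yes p∈ = inj₁ (hw , λ i i≢j i≢k →
            sym (DiffersAt.agree du i (∉-pair p∈ i≢j i≢k) (∉-pair q∈ i≢j i≢k)))

  cliques : CliquesOnEdge n u v
  cliques = record { clique = clique ; largest = largest ; meet = meet ; cover = common-neighbour }
    where
    clique : CType → PtSet m
    clique type1 = C₁
    clique type2 = C₂
    clique type3 = C₃

    largest : ∀ t → LargestContaining n t u v (clique t)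
    largest type1 = clique₁ , u∈C₁ , v∈C₁ , largest₁
    largest type2 = clique₂ , (k , tt , sym u≡₂) , (j , tt , sym v≡₂) , largest₂
    largest type3 = clique₃ , (j , j∈I₃ , sym u≡₃) , (k , k∈I₃ , sym v≡₃) , largest₃

    meet : ∀ {t t′} → t ≢ t′ → ∀ {y} → y ∈ clique t → y ∈ clique t′ → Pair u v y
    meet {type1} {type1} t≢t = contradiction refl t≢t
    meet {type2} {type2} t≢t = contradiction refl t≢t
    meet {type3} {type3} t≢t = contradiction refl t≢t
    meet {type1} {type2} _ = C₁∩C₂
    meet {type1} {type3} _ = C₁∩C₃
    meet {type2} {type3} _ = C₂∩C₃
    meet {type2} {type1} _ y∈C₂ y∈C₁ = C₁∩C₂ y∈C₁ y∈C₂
    meet {type3} {type1} _ y∈C₃ y∈C₁ = C₁∩C₃ y∈C₁ y∈C₃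
    meet {type3} {type2} _ y∈C₃ y∈C₂ = C₂∩C₃ y∈C₂ y∈C₃

-- Part (i): every edge carries its three largest cliques.  The construction is
-- abstract, since everything that follows uses only the fields of the record.
abstract
  cliquesOnEdge : ∀ {u v : Pt m} → IsVertex n u → IsVertex n v → Adj u v → CliquesOnEdge n u v
  cliquesOnEdge {n = n} {u} {v} hu hv u~v with adj⇒move (trans hu (sym hv)) u~v
  ... | _ , _ , _ , mv = ThroughEdge.cliques n u v hu hv mv

-- Consequences of part (i)

-- types are coded injectively in Fin 3, for decidability and pigeonhole
typeIndex : CType → Fin 3
typeIndex type1 = zero
typeIndex type2 = suc zero
typeIndex type3 = suc (suc zero)

indexType : Fin 3 → CType
indexType zero             = type1
indexType (suc zero)       = type2
indexType (suc (suc zero)) = type3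

indexType-typeIndex : ∀ t → indexType (typeIndex t) ≡ t
indexType-typeIndex type1 = refl
indexType-typeIndex type2 = refl
indexType-typeIndex type3 = refl

typeIndex-injective : ∀ {t t′} → typeIndex t ≡ typeIndex t′ → t ≡ t′
typeIndex-injective {t} {t′} eq =
  trans (sym (indexType-typeIndex t)) (trans (cong indexType eq) (indexType-typeIndex t′))

_≟ᵗ_ : (t t′ : CType) → Dec (t ≡ t′)
t ≟ᵗ t′ = map′ typeIndex-injective (cong typeIndex) (typeIndex t Fin.≟ typeIndex t′)

typed-subclique : ∀ {t} {C D : PtSet m} → D ⊆ C → TypedClique n t C → TypedClique n t D
typed-subclique {t = type1} D⊆C ((C⊆V , adj) , lift (j , k , j≢k , diff)) =
  (C⊆V ∘ D⊆C , λ x∈ y∈ → adj (D⊆C x∈) (D⊆C y∈)) ,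
  lift (j , k , j≢k , λ x∈ y∈ → diff (D⊆C x∈) (D⊆C y∈))
typed-subclique {t = type2} {D = D} D⊆C ((C⊆V , adj) , (a , x , I , a≥1 , a≤n , sx , C⊆ , _)) =
  (C⊆V ∘ D⊆C , λ y∈ z∈ → adj (D⊆C y∈) (D⊆C z∈)) , (a , x , I′ , a≥1 , a≤n , sx , D⊆ , ⊆D)
  where
  I′ : Pred (Fin _) 0ℓ
  I′ i = i ∈ I × plusAt x a i ∈ D
  D⊆ : D ⊆ (λ y → ∃[ i ] (i ∈ I′ × y ≡ plusAt x a i))
  D⊆ y∈D with C⊆ (D⊆C y∈D)
  ... | i , i∈I , refl = i , (i∈I , y∈D) , refl
  ⊆D : (λ y → ∃[ i ] (i ∈ I′ × y ≡ plusAt x a i)) ⊆ D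
  ⊆D (_ , (_ , y∈D) , refl) = y∈D
typed-subclique {t = type3} {D = D} D⊆C ((C⊆V , adj) , (a , x , I , a≥1 , sx , a≤x , C⊆ , _)) =
  (C⊆V ∘ D⊆C , λ y∈ z∈ → adj (D⊆C y∈) (D⊆C z∈)) ,
  (a , x , I′ , a≥1 , sx , (λ i i∈I′ → a≤x i (proj₁ i∈I′)) , D⊆ , ⊆D)
  where
  I′ : Pred (Fin _) 0ℓ
  I′ i = i ∈ I × minusAt x a i ∈ D
  D⊆ : D ⊆ (λ y → ∃[ i ] (i ∈ I′ × y ≡ minusAt x a i))
  D⊆ y∈D with C⊆ (D⊆C y∈D)
  ... | i , i∈I , refl = i , (i∈I , y∈D) , refl
  ⊆D : (λ y → ∃[ i ] (i ∈ I′ × y ≡ minusAt x a i)) ⊆ D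
  ⊆D (_ , (_ , y∈D) , refl) = y∈D

largest⇒maximal : ∀ {t} {u v : Pt m} {C} → LargestContaining n t u v C → MaximalContaining n t u C
largest⇒maximal (typed , u∈C , v∈C , largest) =
  typed , u∈C , λ D typed′ C⊆D → largest D typed′ (C⊆D u∈C) (C⊆D v∈C)

maximal≐largest : ∀ {t} {u w : Pt m} {C G} → MaximalContaining n t u C → w ∈ C →
                  LargestContaining n t u w G → C ≐ G
maximal≐largest {C = C} {G} (typed , u∈C , maximal) w∈C (typedG , _ , _ , largest) =
  C⊆G , maximal G typedG C⊆G
  where C⊆G : C ⊆ G
        C⊆G = largest C typed u∈C w∈C

module CliquesOnEdgeFacts {u v : Pt m} (E : CliquesOnEdge n u v) where
  open CliquesOnEdge E

  u∈clique : ∀ t → u ∈ clique t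
  u∈clique t = proj₁ (proj₂ (largest t))

  v∈clique : ∀ t → v ∈ clique t
  v∈clique t = proj₁ (proj₂ (proj₂ (largest t)))

  clique-adjacent : ∀ t {x y} → x ∈ clique t → y ∈ clique t → x ≢ y → Adj x y
  clique-adjacent t = proj₂ (proj₁ (proj₁ (largest t)))

  intersection : ∀ {t t′} → t ≢ t′ → (clique t ∩ clique t′) ≐ Pair u v
  intersection {t} {t′} t≢t′ = (λ (y∈ , y∈′) → meet t≢t′ y∈ y∈′) , pair⊆
    where
    pair⊆ : Pair u v ⊆ (clique t ∩ clique t′)
    pair⊆ (inj₁ refl) = u∈clique t , u∈clique t′
    pair⊆ (inj₂ refl) = v∈clique t , v∈clique t′

  typeOf : ∀ {w} → IsVertex n w → Adj u w → Adj v w → Σ CType λ t → w ∈ clique t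
  typeOf hw u~w v~w with cover hw u~w v~w
  ... | inj₁ w∈C₁         = type1 , w∈C₁
  ... | inj₂ (inj₁ w∈C₂) = type2 , w∈C₂
  ... | inj₂ (inj₂ w∈C₃) = type3 , w∈C₃

  type-unique : ∀ {w t t′} → Adj u w → Adj v w → w ∈ clique t → w ∈ clique t′ → t′ ≡ t
  type-unique {w} {t} {t′} u~w v~w w∈ w∈′ with t′ ≟ᵗ t
  ... | yes t′≡t = t′≡t
  ... | no t′≢t with meet t′≢t w∈′ w∈
  ...   | inj₁ w≡u = contradiction (sym w≡u) (adj⇒≢ {x = u} {w} u~w)
  ...   | inj₂ w≡v = contradiction (sym w≡v) (adj⇒≢ {x = v} {w} v~w)

partI : PartI m n
partI {m} {n} u v hu hv u~v =
  clique type1 , clique type2 , clique type3 , largest type1 , largest type2 , largest type3 ,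
  intersection {type1} {type2} (λ ()) , intersection {type1} {type3} (λ ()) ,
  intersection {type2} {type3} (λ ()) , λ _ → cover
  where
  E : CliquesOnEdge n u v
  E = cliquesOnEdge hu hv u~v
  open CliquesOnEdge E
  open CliquesOnEdgeFacts E

partII-partition : ∀ {u : Pt m} → IsVertex n u → (t : CType) →
  (∀ C → MaximalContaining n t u C → ∀ w → w ∈ C → w ≢ u → Nbr n u w) ×
  (∀ w → Nbr n u w → Σ (PtSet m) λ C → MaximalContaining n t u C × w ∈ C) ×
  (∀ C C′ → MaximalContaining n t u C → MaximalContaining n t u C′ →
     ∀ w → w ≢ u → w ∈ C → w ∈ C′ → C ≐ C′)
partII-partition {m = m} {n = n} {u = u} hu t = neighbours , covered , disjoint
  where
  neighbours : ∀ C → MaximalContaining n t u C → ∀ w → w ∈ C → w ≢ u → Nbr n u w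
  neighbours C (((C⊆V , adj) , _) , u∈C , _) w w∈C w≢u = C⊆V w∈C , adj u∈C w∈C (w≢u ∘ sym)
  covered : ∀ w → Nbr n u w → Σ (PtSet _) λ C → MaximalContaining n t u C × w ∈ C
  covered w (hw , u~w) = clique t , largest⇒maximal (largest t) , v∈clique t
    where E : CliquesOnEdge n u w
          E = cliquesOnEdge hu hw u~w
          open CliquesOnEdge E
          open CliquesOnEdgeFacts E
  disjoint : ∀ C C′ → MaximalContaining n t u C → MaximalContaining n t u C′ →
             ∀ w → w ≢ u → w ∈ C → w ∈ C′ → C ≐ C′
  disjoint C C′ maxC maxC′ w w≢u w∈C w∈C′ =
    (λ x∈C → proj₂ C′≐G (proj₁ C≐G x∈C)) , (λ x∈C′ → proj₂ C≐G (proj₁ C′≐G x∈C′))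
    where
    E : CliquesOnEdge n u w
    E = cliquesOnEdge hu (proj₁ nbr) (proj₂ nbr)
      where nbr = neighbours C maxC w w∈C w≢u
    C≐G : C ≐ CliquesOnEdge.clique E t
    C≐G = maximal≐largest maxC w∈C (CliquesOnEdge.largest E t)
    C′≐G : C′ ≐ CliquesOnEdge.clique E t
    C′≐G = maximal≐largest maxC′ w∈C′ (CliquesOnEdge.largest E t)

-- An edge vw inside the neighbourhood of u lies in exactly one maximal clique
-- through u: the clique through the edge uv whose type is that of w.
module EdgeInNeighbourhood {u v w : Pt m} (hu : IsVertex n u) (hv : IsVertex n v) (hw : IsVertex n w)
                           (u~v : Adj u v) (u~w : Adj u w) (v~w : Adj v w) where
  E : CliquesOnEdge n u v
  E = cliquesOnEdge hu hv u~v
  open CliquesOnEdge E public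
  open CliquesOnEdgeFacts E public

  edgeType : CType
  edgeType = proj₁ (typeOf {w = w} hw u~w v~w)

  w∈clique : w ∈ clique edgeType
  w∈clique = proj₂ (typeOf {w = w} hw u~w v~w)

  unique-clique : ∀ t′ C′ → MaximalContaining n t′ u C′ → v ∈ C′ → w ∈ C′ →
                  t′ ≡ edgeType × C′ ≐ clique edgeType
  unique-clique t′ C′ maxC′ v∈C′ w∈C′ with maximal≐largest maxC′ v∈C′ (largest t′)
  ... | C′≐ with type-unique {t = edgeType} {t′} u~w v~w w∈clique (proj₁ C′≐ w∈C′)
  ...   | refl = refl , C′≐

  triangle-typed : TypedClique n edgeType (Triple u v w)
  triangle-typed = typed-subclique triangle⊆ (proj₁ (largest edgeType))
    where
    triangle⊆ : Triple u v w ⊆ clique edgeType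
    triangle⊆ (inj₁ refl)        = u∈clique edgeType
    triangle⊆ (inj₂ (inj₁ refl)) = v∈clique edgeType
    triangle⊆ (inj₂ (inj₂ refl)) = w∈clique

  triangle-type-unique : ∀ t′ → TypedClique n t′ (Triple u v w) → t′ ≡ edgeType
  triangle-type-unique t′ typed = type-unique {t = edgeType} {t′} u~w v~w w∈clique
    (proj₂ (proj₂ (proj₂ (largest t′))) (Triple u v w) typed
      (inj₁ refl) (inj₂ (inj₁ refl)) (inj₂ (inj₂ refl)))

partII : PartII m n
partII {m} {n} u hu = partII-partition hu , edge
  where
  edge : ∀ v w → Nbr n u v → Nbr n u w → Adj v w →
     (Σ CType λ t → Σ (PtSet m) λ C →
        MaximalContaining n t u C × v ∈ C × w ∈ C ×
        (∀ t′ C′ → MaximalContaining n t′ u C′ → v ∈ C′ → w ∈ C′ → t′ ≡ t × C′ ≐ C)) ×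
     (Σ CType λ t → TypedClique n t (Triple u v w) ×
        (∀ t′ → TypedClique n t′ (Triple u v w) → t′ ≡ t))
  edge v w (hv , u~v) (hw , u~w) v~w =
    (edgeType , clique edgeType , largest⇒maximal (largest edgeType) , v∈clique edgeType , w∈clique ,
     unique-clique) ,
    (edgeType , triangle-typed , triangle-type-unique)
    where open EdgeInNeighbourhood {u = u} {v} {w} hu hv hw u~v u~w v~w

-- pigeonhole: among four distinct common neighbours of an edge, two share one
-- of the three cliques and are therefore adjacent
four-common-neighbours : ∀ {u v : Pt m} → CliquesOnEdge n u v → (g : Fin 4 → Pt m) →
  (∀ i → IsVertex n (g i)) → (∀ i → Adj u (g i)) → (∀ i → Adj v (g i)) →
  (∀ i i′ → g i ≡ g i′ → i ≡ i′) → ∃[ i ] ∃[ i′ ] (i ≢ i′ × Adj (g i) (g i′))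
four-common-neighbours {m = m} {n = n} {u = u} {v} E g vertex u~g v~g injective =
  pick (Fin.pigeonhole (n<1+n 3) (typeIndex ∘ proj₁ ∘ type))
  where
  open CliquesOnEdge E
  open CliquesOnEdgeFacts E
  type : ∀ i → Σ CType λ t → g i ∈ clique t
  type i = typeOf {w = g i} (vertex i) (u~g i) (v~g i)

  same-clique : ∀ {i i′} → proj₁ (type i) ≡ proj₁ (type i′) → i ≢ i′ → Adj (g i) (g i′)
  same-clique {i} {i′} same i≢i′ =
    clique-adjacent (proj₁ (type i)) (proj₂ (type i))
      (subst (λ t → g i′ ∈ clique t) (sym same) (proj₂ (type i′))) (i≢i′ ∘ injective i i′)

  pick : ∃[ i ] ∃[ i′ ] (i <ᶠ i′ × typeIndex (proj₁ (type i)) ≡ typeIndex (proj₁ (type i′))) →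
         ∃[ i ] ∃[ i′ ] (i ≢ i′ × Adj (g i) (g i′))
  pick (i , i′ , i<i′ , same) =
    i , i′ , Fin.<⇒≢ i<i′ , same-clique (typeIndex-injective {proj₁ (type i)} same) (Fin.<⇒≢ i<i′)

-- Part (iii): in an induced K₁,₁,₄ the four leaves would be distinct common
-- neighbours of the edge between the two hubs, yet pairwise non-adjacent
partIII : PartIII m n
partIII {m} {n} (f , vertex , injective , adj⇔) =
  leaves-nonadjacent (four-common-neighbours hubs (f ∘ leaf) (vertex ∘ leaf)
    (λ i → adjacent zero (leaf i) (λ ())) (λ i → adjacent (suc zero) (leaf i) (λ ()))
    (λ i i′ → Fin.suc-injective ∘ Fin.suc-injective ∘ injective (leaf i) (leaf i′)))
  where
  leaf : Fin 4 → Fin 6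
  leaf i = suc (suc i)
  adjacent : ∀ i j → K114Adj i j → Adj (f i) (f j)
  adjacent i j = Equivalence.from (adj⇔ i j)
  hubs : CliquesOnEdge n (f zero) (f (suc zero))
  hubs = cliquesOnEdge (vertex zero) (vertex (suc zero)) (adjacent zero (suc zero) (λ ()))
  leaves-nonadjacent : ∃[ i ] ∃[ i′ ] (i ≢ i′ × Adj (f (leaf i)) (f (leaf i′))) → ⊥
  leaves-nonadjacent (i , i′ , _ , leaves-adjacent) =
    Equivalence.to (adj⇔ (leaf i) (leaf i′)) leaves-adjacent refl

mainTheorem10 : (m n : ℕ) → PartI m n × PartII m n × PartIII m n
mainTheorem10 m n = partI , partII , partIII
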